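{- For an integer $x\ge 2$ let $n=4x+4$ and let $\mathcal{S}=\mathcal{S}^{(x)}=\{S_0,\ldots,S_{n+2}\}\subseteq\mathcal{P}([n])$ be the family $S_0=[n]$; $S_1=\{2,\tfrac n2+1,\ldots,n\}$; $S_2=\{1,3,\ldots,\tfrac n2,n\}$; $S_3=\{1,4,\ldots,\tfrac n2+2\}$; $S_4=\{1,3,\tfrac n2+3,\ldots,n\}$; $S_{k}=\{1,4,k+1,\ldots,\tfrac n2+k-2\}$ for $5\le k\le \tfrac n4+2$; $S_{k}=\{1,4,k+1,\ldots,\tfrac n2+k-3\}$ for $\tfrac n4+3\le k\le \tfrac n2$; $S_{\frac n2+1}=\{2,4,\tfrac n2+2,\ldots,n-2\}$; $S_{\frac n2+2}=\{2,4,\tfrac n2+3,\ldots,n-1\}$; $S_{\frac n2+3}=\{2,3,\tfrac n2+4,\ldots,n\}$; $S_{k}=\{2,3,5,\ldots,k-\tfrac n2+1,k+1,\ldots,n\}$ for $\tfrac n2+4\le k\le \tfrac{3n}4$; $S_{\frac{3n}4+1}=\{2,3,5,\ldots,\tfrac n4+3,\tfrac{3n}4+2,\ldots,n-1\}$; $S_{k}=\{2,3,5,\ldots,k-\tfrac n2+2,k+1,\ldots,n\}$ for $\tfrac{3n}4+2\le k\le n-1$; $S_n=\{3,5,\ldots,\tfrac n2+2,\tfrac{3n}4+1\}$; $S_{n+1}=\{\tfrac{3n}4+2,\ldots,n\}$; $S_{n+2}=\{1,5,\ldots,\tfrac n4+2\}$. Then $\lim_{x\to\infty}\frac{|\ma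thcal{S}^{(x)}|}{|cl(\mathcal{S}^{(x)})|}=0$.
   Context: $[n]=\{1,\ldots,n\}$. A notation $\{\ldots,a,\ldots,b,\ldots\}$ with $a\le b$ means all consecutive integers from $a$ to $b$ are included (empty range if $b<a$). For a family $\mathcal{S}$ of sets, $cl(\mathcal{S})$ denotes its union closure: $A\in cl(\mathcal{S})$ iff $A=\bigcup_{B\in\mathcal{T}}B$ for some subfamily $\mathcal{T}\subseteq\mathcal{S}$. -}

module Defs where

open import Data.Nat using (ℕ; zero; suc; _+_; _*_; _∸_; _≤ᵇ_; _≡ᵇ_)
open import Data.Bool using (Bool; true; false; _∧_; _∨_; if_then_else_)
import Data.Bool as B
open import Data.Fin using (Fin; toℕ)
open import Data.Fin.Subset using (Subset; ⋃)
open import Data.List using (List; []; _∷_; map; length; upTo; deduplicate; _++_)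
open import Data.Vec using (tabulate)
open import Data.Vec.Properties using (≡-dec)

-- Ground set [n] = {1,…,n} is represented by Fin n: element e ∈ [n]
-- corresponds to the index e - 1.

-- n = 4x + 4,  n/2 = 2x+2,  n/4 = x+1,  3n/4 = 3x+3
nOf : ℕ → ℕ
nOf x = 4 * x + 4

rng : ℕ → ℕ → ℕ → Bool
rng a b e = (a ≤ᵇ e) ∧ (e ≤ᵇ b)

is : ℕ → ℕ → Bool
is a e = e ≡ᵇ a

memb : ℕ → ℕ → ℕ → Bool
memb x k e =
  if k ≡ᵇ 0 then rng 1 n e
  else if k ≡ᵇ 1 then is 2 e ∨ rng (h + 1) n e
  else if k ≡ᵇ 2 then is 1 e ∨ rng 3 h e ∨ is n e
  else if k ≡ᵇ 3 then is 1 e ∨ rng 4 (h + 2) e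
  else if k ≡ᵇ 4 then is 1 e ∨ is 3 e ∨ rng (h + 3) n e
  else if k ≤ᵇ q + 2 then is 1 e ∨ is 4 e ∨ rng (k + 1) (h + k ∸ 2) e
  else if k ≤ᵇ h then is 1 e ∨ is 4 e ∨ rng (k + 1) (h + k ∸ 3) e
  else if k ≡ᵇ h + 1 then is 2 e ∨ is 4 e ∨ rng (h + 2) (n ∸ 2) e
  else if k ≡ᵇ h + 2 then is 2 e ∨ is 4 e ∨ rng (h + 3) (n ∸ 1) e
  else if k ≡ᵇ h + 3 then is 2 e ∨ is 3 e ∨ rng (h + 4) n e
  else if k ≤ᵇ t then is 2 e ∨ is 3 e ∨ rng 5 (k ∸ h + 1) e ∨ rng (k + 1) n e
  else if k ≡ᵇ t + 1 then is 2 e ∨ is 3 e ∨ rng 5 (q + 3) e ∨ rng (t + 2) (n ∸ 1) e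
  else if k ≤ᵇ n ∸ 1 then is 2 e ∨ is 3 e ∨ rng 5 (k ∸ h + 2) e ∨ rng (k + 1) n e
  else if k ≡ᵇ n then is 3 e ∨ rng 5 (h + 2) e ∨ is (t + 1) e
  else if k ≡ᵇ n + 1 then rng (t + 2) n e
  else is 1 e ∨ rng 5 (q + 2) e
  where
  n h q t : ℕ
  n = nOf x
  h = 2 * x + 2
  q = x + 1
  t = 3 * x + 3

setS : (x k : ℕ) → Subset (nOf x)
setS x k = tabulate (λ j → memb x k (suc (toℕ j)))

family : (x : ℕ) → List (Subset (nOf x))
family x = map (setS x) (upTo (nOf x + 3))

sublists : ∀ {a} {A : Set a} → List A → List (List A)
sublists [] = [] ∷ []
sublists (y ∷ ys) = map (y ∷_) (sublists ys) ++ sublists ys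

_≟ˢ_ : ∀ {m} (A B : Subset m) → _
_≟ˢ_ = ≡-dec B._≟_

card : ∀ {m} → List (Subset m) → ℕ
card xs = length (deduplicate _≟ˢ_ xs)

-- the union closure cl(𝒮): all unions of subfamilies (the empty
-- subfamily gives ∅), listed with repetitions
cl : ∀ {m} → List (Subset m) → List (Subset m)
cl 𝒮 = map ⋃ (sublists 𝒮)

-- For 5 ≤ k ≤ n/4 + 2 the set S_k is {1,4} together with the window
-- {k+1, …, k+2x} of width n/2 − 2.  Hence for ℓ < u in that range the least
-- element of S_ℓ ∪ S_u above 4 is ℓ+1 and its largest element is u+2x, so the
-- union determines the pair (ℓ, u).  Taking ℓ among the first ⌊(x−1)/2⌋ of these
-- x − 1 indices and u among the remaining ⌈(x−1)/2⌉ gives about x²/4 distinct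
-- members of cl(𝒮), while |𝒮| ≤ n + 3 is linear in x.
module Submission where

open import Defs
open import Data.Nat using (ℕ; _*_; _≤_; _<_)
open import Data.Product using (∃-syntax)

open import Data.Nat using (zero; suc; _+_; _∸_; z<s; s≤s; s≤s⁻¹; ⌊_/2⌋; ⌈_/2⌉)
open import Data.Nat.Properties
open import Data.Nat.Tactic.RingSolver using (solve-∀)
open import Data.Bool using (Bool; T)
open import Data.Bool.Properties using (T-≡; T-∧)
import Data.Product as Product
open import Data.Product using (_×_; _,_; proj₁; proj₂; map₁; map₂)
open import Data.Sum using (inj₁; inj₂)
open import Data.Fin using (Fin; toℕ; fromℕ<)
open import Data.Fin.Properties using (toℕ-fromℕ<; toℕ-injective; toℕ<n; injective⇒≤; *↔×)
open import Data.Fin.Subset using (Subset; _∈_; _⊆_; _∪_; ⋃)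
open import Data.Fin.Subset.Properties using (x∈p∪q⁺; x∈p∪q⁻; ∪-identityʳ; ⊆-reflexive)
open import Data.List using (List; []; _∷_; map; upTo; deduplicate; length; lookup)
open import Data.List.Properties using (length-deduplicate; length-map; length-upTo; upTo-∷ʳ)
open import Data.List.Membership.Propositional using () renaming (_∈_ to _∈ₗ_)
open import Data.List.Membership.Propositional.Properties using (∈-++⁺ˡ; ∈-++⁺ʳ; ∈-map⁺; ∈-upTo⁺; ∈-deduplicate⁺)
open import Data.List.Relation.Unary.Any using (here; index)
open import Data.List.Relation.Unary.Any.Properties using (lookup-index)
open import Data.List.Relation.Binary.Sublist.Propositional using ([]; _∷_; _∷ʳ_; from∈; ⊆-refl) renaming (_⊆_ to _⊆ₗ_)
open import Data.List.Relation.Binary.Sublist.Propositional.Properties using (map⁺; ++⁺; ++⁺ʳ)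
open import Data.Vec using (tabulate)
open import Data.Vec.Properties using (lookup∘tabulate; []=⇒lookup; lookup⇒[]=)
open import Function using (_∘_; Injective; _⇔_; mk⇔; Equivalence; Injection; Inverse)
open import Function.Properties.Inverse using (↔⇒↣)
open import Function.Properties.Equivalence using () renaming (trans to ⇔-trans)
open import Relation.Binary.Definitions using (DecidableEquality)
open import Relation.Binary.PropositionalEquality

private
  variable
    a b e i j k m n x ℓ u ℓ′ u′ : ℕ

T-rng : T (rng a b e) ⇔ (a ≤ e × e ≤ b)
T-rng {a} {b} {e} = mk⇔
  (Product.map (≤ᵇ⇒≤ a e) (≤ᵇ⇒≤ e b) ∘ Equivalence.to T-∧)
  (Equivalence.from T-∧ ∘ Product.map ≤⇒≤ᵇ ≤⇒≤ᵇ)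

∈tabulate⇔ : (f : Fin n → Bool) (t : Fin n) → t ∈ tabulate f ⇔ T (f t)
∈tabulate⇔ f t = mk⇔
  (λ t∈ → Equivalence.from T-≡ (trans (sym (lookup∘tabulate f t)) ([]=⇒lookup t∈)))
  (λ ft → lookup⇒[]= t (tabulate f) (trans (lookup∘tabulate f t) (Equivalence.to T-≡ ft)))

memb-window : 5 ≤ k → k ≤ x + 3 → 5 ≤ e → memb x k e ≡ rng (suc k) (k + 2 * x) e
memb-window {k} {x} {e}
  (s≤s (s≤s (s≤s (s≤s (s≤s _))))) k≤x+3 (s≤s (s≤s (s≤s (s≤s (s≤s _)))))
  rewrite Equivalence.to T-≡ (≤⇒≤ᵇ (≤-trans k≤x+3 (≤-reflexive (sym (+-assoc x 1 2)))))
  = cong₂ (λ a b → rng a b e) (+-comm k 1) upper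
  where
  shift : ∀ y l → 2 * y + 2 + l ≡ l + 2 * y + 2
  shift = solve-∀
  upper : 2 * x + 2 + k ∸ 2 ≡ k + 2 * x
  upper = trans (cong (_∸ 2) (shift x k)) (m+n∸n≡m (k + 2 * x) 2)

-- Position i of Fin (nOf x) is the element i + 1, so in positions the window is [k, k + 2x).
∈setS⇔ : 5 ≤ k → k ≤ x + 3 → (i<n : i < nOf x) → 4 ≤ i →
         fromℕ< i<n ∈ setS x k ⇔ (k ≤ i × i < k + 2 * x)
∈setS⇔ {k} {x} {i} 5≤k k≤x+3 i<n 4≤i = ⇔-trans (∈tabulate⇔ _ (fromℕ< i<n)) window
  where
  window : T (memb x k (suc (toℕ (fromℕ< i<n)))) ⇔ (k ≤ i × i < k + 2 * x)
  window rewrite toℕ-fromℕ< i<n | memb-window 5≤k k≤x+3 (s≤s 4≤i) =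
    ⇔-trans T-rng (mk⇔ (map₁ s≤s⁻¹) (map₁ s≤s))

window-width>0 : 5 ≤ k → k < x + 3 → 0 < 2 * x
window-width>0 {x = zero} 5≤k k<3 with ≤-trans 5≤k (<⇒≤ k<3)
... | s≤s (s≤s (s≤s ()))
window-width>0 {x = suc x} _ _ = z<s

window-end≤n : k ≤ x + 3 → k + 2 * x ≤ nOf x
window-end≤n {k} {x} k≤x+3 = begin
  k + 2 * x                 ≤⟨ +-monoˡ-≤ (2 * x) k≤x+3 ⟩
  x + 3 + 2 * x             ≤⟨ m≤m+n _ (x + 1) ⟩
  x + 3 + 2 * x + (x + 1)   ≡⟨ window-slack x ⟩
  nOf x                     ∎
  where
  open ≤-Reasoning
  window-slack : ∀ y → y + 3 + 2 * y + (y + 1) ≡ 4 * y + 4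
  window-slack = solve-∀

pairUnion : (x ℓ u : ℕ) → Subset (nOf x)
pairUnion x ℓ u = setS x ℓ ∪ setS x u

WindowPair : (x ℓ u : ℕ) → Set
WindowPair x ℓ u = 5 ≤ ℓ × ℓ < u × u ≤ x + 3

pairUnion-span : WindowPair x ℓ u → (i<n : i < nOf x) → 4 ≤ i →
                 fromℕ< i<n ∈ pairUnion x ℓ u → ℓ ≤ i × i < u + 2 * x
pairUnion-span {x} {ℓ} {u} (5≤ℓ , ℓ<u , u≤x+3) i<n 4≤i i∈U
  with x∈p∪q⁻ (setS x ℓ) (setS x u) i∈U
... | inj₁ i∈Sℓ = map₂ (λ i<ℓ+2x → <-≤-trans i<ℓ+2x (+-monoˡ-≤ (2 * x) (<⇒≤ ℓ<u)))
  (Equivalence.to (∈setS⇔ 5≤ℓ (<⇒≤ (<-≤-trans ℓ<u u≤x+3)) i<n 4≤i) i∈Sℓ)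
... | inj₂ i∈Su = map₁ (≤-trans (<⇒≤ ℓ<u))
  (Equivalence.to (∈setS⇔ (≤-trans 5≤ℓ (<⇒≤ ℓ<u)) u≤x+3 i<n 4≤i) i∈Su)

pairUnion-lower : WindowPair x ℓ u → WindowPair x ℓ′ u′ →
                  pairUnion x ℓ u ⊆ pairUnion x ℓ′ u′ → ℓ′ ≤ ℓ
pairUnion-lower {x} {ℓ} (5≤ℓ , ℓ<u , u≤x+3) wp′ U⊆U′ =
  proj₁ (pairUnion-span wp′ ℓ<n (<⇒≤ 5≤ℓ) (U⊆U′ (x∈p∪q⁺ (inj₁ ℓ∈Sℓ))))
  where
  ℓ<x+3 : ℓ < x + 3
  ℓ<x+3 = <-≤-trans ℓ<u u≤x+3
  ℓ<ℓ+2x : ℓ < ℓ + 2 * x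
  ℓ<ℓ+2x = m<m+n ℓ (window-width>0 5≤ℓ ℓ<x+3)
  ℓ<n : ℓ < nOf x
  ℓ<n = <-≤-trans ℓ<ℓ+2x (window-end≤n (<⇒≤ ℓ<x+3))
  ℓ∈Sℓ : fromℕ< ℓ<n ∈ setS x ℓ
  ℓ∈Sℓ = Equivalence.from (∈setS⇔ 5≤ℓ (<⇒≤ ℓ<x+3) ℓ<n (<⇒≤ 5≤ℓ))
                          (≤-refl , ℓ<ℓ+2x)

pairUnion-upper : WindowPair x ℓ u → WindowPair x ℓ′ u′ →
                  pairUnion x ℓ u ⊆ pairUnion x ℓ′ u′ → u ≤ u′
pairUnion-upper {x} {ℓ} {suc v} {u′ = u′} (5≤ℓ , ℓ<u , u≤x+3) wp′ U⊆U′ =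
  +-cancelʳ-≤ (2 * x) (suc v) u′
    (proj₂ (pairUnion-span wp′ w<n 4≤w (U⊆U′ (x∈p∪q⁺ (inj₂ w∈Su)))))
  where
  5≤v : 5 ≤ v
  5≤v = ≤-trans 5≤ℓ (s≤s⁻¹ ℓ<u)
  w<n : v + 2 * x < nOf x
  w<n = window-end≤n u≤x+3
  4≤w : 4 ≤ v + 2 * x
  4≤w = ≤-trans (<⇒≤ 5≤v) (m≤m+n v (2 * x))
  w∈Su : fromℕ< w<n ∈ setS x (suc v)
  w∈Su = Equivalence.from (∈setS⇔ (≤-trans 5≤ℓ (<⇒≤ ℓ<u)) u≤x+3 w<n 4≤w)
    (m<m+n v (window-width>0 5≤ℓ (<-≤-trans ℓ<u u≤x+3)) , ≤-refl)

pairUnion-injective : WindowPair x ℓ u → WindowPair x ℓ′ u′ →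
                      pairUnion x ℓ u ≡ pairUnion x ℓ′ u′ → ℓ ≡ ℓ′ × u ≡ u′
pairUnion-injective wp wp′ U≡U′ =
    ≤-antisym (pairUnion-lower wp′ wp U′⊆U) (pairUnion-lower wp wp′ U⊆U′)
  , ≤-antisym (pairUnion-upper wp wp′ U⊆U′) (pairUnion-upper wp′ wp U′⊆U)
  where
  U⊆U′ = ⊆-reflexive U≡U′
  U′⊆U = ⊆-reflexive (sym U≡U′)

sublists-complete : ∀ {A : Set} {xs ys : List A} → xs ⊆ₗ ys → xs ∈ₗ sublists ys
sublists-complete [] = here refl
sublists-complete {ys = y ∷ ys} (.y ∷ʳ xs⊆ys) =
  ∈-++⁺ʳ (map (y ∷_) (sublists ys)) (sublists-complete xs⊆ys)
sublists-complete {ys = y ∷ ys} (refl ∷ xs⊆ys) =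
  ∈-++⁺ˡ (∈-map⁺ (y ∷_) (sublists-complete xs⊆ys))

pair⊆upTo : i < j → j < n → i ∷ j ∷ [] ⊆ₗ upTo n
pair⊆upTo {n = suc n} i<j j<1+n rewrite sym (upTo-∷ʳ n) with m<1+n⇒m<n∨m≡n j<1+n
... | inj₁ j<n = ++⁺ʳ (n ∷ []) (pair⊆upTo i<j j<n)
... | inj₂ refl = ++⁺ (from∈ (∈-upTo⁺ i<j)) ⊆-refl

∪∈cl : (f : ℕ → Subset m) → i < j → j < n → f i ∪ f j ∈ₗ cl (map f (upTo n))
∪∈cl {i = i} {j} {n} f i<j j<n =
  subst (_∈ₗ cl (map f (upTo n))) (cong (f i ∪_) (∪-identityʳ (f j)))
    (∈-map⁺ ⋃ (sublists-complete (map⁺ f (pair⊆upTo i<j j<n))))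

injective⇒≤length-deduplicate : ∀ {A : Set} {xs : List A} (_≟_ : DecidableEquality A)
                                (f : Fin m → A) → Injective _≡_ _≡_ f → (∀ t → f t ∈ₗ xs) →
                                m ≤ length (deduplicate _≟_ xs)
injective⇒≤length-deduplicate {xs = xs} _≟_ f f-injective f∈xs =
  injective⇒≤ position-injective
  where
  ys : List _
  ys = deduplicate _≟_ xs
  position : Fin _ → Fin (length ys)
  position t = index (∈-deduplicate⁺ _≟_ (f∈xs t))
  position-injective : Injective _≡_ _≡_ position
  position-injective {t} {t′} eq = f-injective (begin
    f t                   ≡⟨ lookup-index (∈-deduplicate⁺ _≟_ (f∈xs t)) ⟩
    lookup ys (position t)  ≡⟨ cong (lookup ys) eq ⟩
    lookup ys (position t′) ≡⟨ lookup-index (∈-deduplicate⁺ _≟_ (f∈xs t′)) ⟨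
    f t′                  ∎)
    where open ≡-Reasoning

pairUnion∈cl : WindowPair x ℓ u → pairUnion x ℓ u ∈ₗ cl (family x)
pairUnion∈cl {x} {ℓ} {u} (_ , ℓ<u , u≤x+3) = ∪∈cl (setS x) ℓ<u (begin-strict
  u             ≤⟨ m≤m+n u (2 * x) ⟩
  u + 2 * x     ≤⟨ window-end≤n u≤x+3 ⟩
  nOf x         <⟨ m<m+n (nOf x) z<s ⟩
  nOf x + 3     ∎)
  where open ≤-Reasoning

rectangle≤card-cl : ∀ p q → p + q < x → p * q ≤ card (cl (family x))
rectangle≤card-cl {x} p q p+q<x =
  injective⇒≤length-deduplicate _≟ˢ_ (union ∘ Inverse.to *↔×)
    (λ eq → Injection.injective (↔⇒↣ *↔×) (union-injective eq))
    (λ t → let (a , b) = Inverse.to *↔× t in pairUnion∈cl (window a b))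
  where
  window : (a : Fin p) (b : Fin q) → WindowPair x (5 + toℕ a) (5 + (p + toℕ b))
  window a b = m≤m+n 5 (toℕ a)
             , +-monoʳ-< 5 (<-≤-trans (toℕ<n a) (m≤m+n p (toℕ b)))
             , ≤-trans (+-monoʳ-≤ 3 (≤-trans (s≤s (+-monoʳ-< p (toℕ<n b))) p+q<x))
                       (≤-reflexive (+-comm 3 x))
  union : Fin p × Fin q → Subset (nOf x)
  union (a , b) = pairUnion x (5 + toℕ a) (5 + (p + toℕ b))
  union-injective : Injective _≡_ _≡_ union
  union-injective {a , b} {a′ , b′} eq = cong₂ _,_
    (toℕ-injective (+-cancelˡ-≡ 5 (toℕ a) (toℕ a′) (proj₁ indices)))
    (toℕ-injective (+-cancelˡ-≡ (5 + p) (toℕ b) (toℕ b′) (proj₂ indices)))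
    where
    indices : 5 + toℕ a ≡ 5 + toℕ a′ × 5 + (p + toℕ b) ≡ 5 + (p + toℕ b′)
    indices = pairUnion-injective {x} {5 + toℕ a} {5 + (p + toℕ b)}
                                  {5 + toℕ a′} {5 + (p + toℕ b′)} (window a b) (window a′ b′) eq

card-family≤ : ∀ x → card (family x) ≤ nOf x + 3
card-family≤ x = ≤-trans (length-deduplicate _≟ˢ_ (family x))
  (≤-reflexive (trans (length-map (setS x) (upTo (nOf x + 3))) (length-upTo (nOf x + 3))))

linear<product : ∀ k p q → 16 * k + 2 ≤ p → p ≤ q → x ≤ suc (p + q) →
                 k * (nOf x + 3) < p * q
linear<product {x} k p q 16k+2≤p p≤q x≤1+p+q = begin-strict
  k * (nOf x + 3)        ≤⟨ *-monoʳ-≤ k size≤16q ⟩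
  k * (16 * q)           ≡⟨ *-assoc k 16 q ⟨
  k * 16 * q             ≡⟨ cong (_* q) (*-comm k 16) ⟩
  16 * k * q             <⟨ m<m+n (16 * k * q) (*-monoʳ-< 2 0<q) ⟩
  16 * k * q + 2 * q     ≡⟨ *-distribʳ-+ q (16 * k) 2 ⟨
  (16 * k + 2) * q       ≤⟨ *-monoˡ-≤ q 16k+2≤p ⟩
  p * q                  ∎
  where
  open ≤-Reasoning
  2≤q : 2 ≤ q
  2≤q = ≤-trans (m≤n+m 2 (16 * k)) (≤-trans 16k+2≤p p≤q)
  expand : ∀ r → 4 * suc (r + r) + 4 + 3 ≡ 8 * r + 11
  expand = solve-∀
  0<q : 0 < q
  0<q = <-≤-trans z<s 2≤q
  x≤1+q+q : x ≤ suc (q + q)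
  x≤1+q+q = ≤-trans x≤1+p+q (s≤s (+-monoˡ-≤ q p≤q))
  size≤16q : nOf x + 3 ≤ 16 * q
  size≤16q = begin
    nOf x + 3                  ≤⟨ +-monoˡ-≤ 3 (+-monoˡ-≤ 4 (*-monoʳ-≤ 4 x≤1+q+q)) ⟩
    4 * suc (q + q) + 4 + 3    ≡⟨ expand q ⟩
    8 * q + 11                 ≤⟨ +-monoʳ-≤ (8 * q) (≤-trans (m≤m+n 11 5) (*-monoʳ-≤ 8 2≤q)) ⟩
    8 * q + 8 * q              ≡⟨ *-distribʳ-+ q 8 8 ⟨
    16 * q                     ∎

corollary1 : (k : ℕ) → 1 ≤ k → ∃[ N ] ((x : ℕ) → 2 ≤ x → N ≤ x →
    k * card (family x) < card (cl (family x)))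
corollary1 k _ = suc (M + M) , bound
  where
  M : ℕ
  M = 16 * k + 2
  bound : (x : ℕ) → 2 ≤ x → suc (M + M) ≤ x → k * card (family x) < card (cl (family x))
  bound (suc n) _ (s≤s M+M≤n) = begin-strict
    k * card (family (suc n))   ≤⟨ *-monoʳ-≤ k (card-family≤ (suc n)) ⟩
    k * (nOf (suc n) + 3)       <⟨ linear<product k p q M≤p (⌊n/2⌋≤⌈n/2⌉ n) (≤-reflexive (sym 1+p+q≡x)) ⟩
    p * q                       ≤⟨ rectangle≤card-cl p q (≤-reflexive 1+p+q≡x) ⟩
    card (cl (family (suc n)))  ∎
    where
    open ≤-Reasoning
    p q : ℕ
    p = ⌊ n /2⌋
    q = ⌈ n /2⌉
    1+p+q≡x : suc (p + q) ≡ suc n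
    1+p+q≡x = cong suc (⌊n/2⌋+⌈n/2⌉≡n n)
    M≤p : M ≤ p
    M≤p = subst (_≤ p) (sym (n≡⌊n+n/2⌋ M)) (⌊n/2⌋-mono M+M≤n)
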